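{- Let $\mathcal{F}$ be a pattern given by good polynomials $F_1(a_1,\dots,a_m),\dots,F_r(a_1,\dots,a_m)$. Then $\mathcal{F}$ is partition regular over $P_\infty$ if and only if it is partition regular over $T$. Moreover, if $\mathcal{F}$ is partition regular over $T$ (respectively, partition regular over $T$ with primitive recursive bounds), then it is partition regular over $\mathbb{N}$ (respectively, partition regular over $\mathbb{N}$ with primitive recursive bounds).
   Context: A polynomial (in one or several variables) is called good if it has nonnegative integer coefficients and zero constant term. $T$ denotes the set of nonzero good polynomials in a single variable $t$. $P_\infty$ denotes the set of nonzero polynomials in countably many variables $x_1,x_2,\dots$ with nonnegative integer coefficients and zero constant term. The size of a good polynomial is the least integer $c$ such that its degree and all its coefficients are at most $c$. $\mathcal{F}$ is partition regular over a set $S$ (one of $T$, $P_\infty$, $\mathbb{N}=\{1,2,\dots\}$) if for every coloring of $S$ with finitely many colors there exist $a_1,\dots,a_m\in S$ such that $F_1(a),\dots,F_r(a)$ all have the same color. Partition regular over $T$ with primitive recursive bounds: there is a primitive recursive function $N_T$ such that every $n$-coloring of $T$ admits such a monochromatic instance with all $F_j(a)$ of size at most $N_T(n)$. Partition regular over $\mathbb{N}$ with primitive recursive bounds: there is a primitive recursive $N$ such that every $n$-coloring of $\{1,\dots,N(n)\}$ admits positive integers $a_1,\dots,a_m$ with all $F_j(a)\in\{1,\dots,N(n)\}$ of the same color. -}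

module Defs where

open import Data.Nat using (ℕ; zero; suc; _+_; _*_; _≤_; _<_; _≟_)
open import Data.Fin using (Fin)
open import Data.List using (List; []; _∷_; _++_; map; concatMap)
open import Data.Vec as Vec using (Vec; []; _∷_; lookup; replicate)
import Data.Vec.Properties as VecP
import Data.List.Properties as ListP
open import Data.Product using (Σ; ∃; ∃-syntax; _×_; _,_)
open import Relation.Nullary using (¬_; yes; no)
open import Relation.Binary.PropositionalEquality using (_≡_)

-- Univariate polynomials (in t), as coefficient lists:
-- the k-th entry is the coefficient of t^k (trailing zeros irrelevant).

UPoly : Set
UPoly = List ℕ

coeffU : UPoly → ℕ → ℕ
coeffU []      _       = 0
coeffU (a ∷ p) zero    = a
coeffU (a ∷ p) (suc k) = coeffU p k

addU : UPoly → UPoly → UPoly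
addU []      q       = q
addU (a ∷ p) []      = a ∷ p
addU (a ∷ p) (b ∷ q) = (a + b) ∷ addU p q

mulU : UPoly → UPoly → UPoly
mulU []      q = []
mulU (a ∷ p) q = addU (map (a *_) q) (0 ∷ mulU p q)

_≈U_ : UPoly → UPoly → Set
p ≈U q = ∀ k → coeffU p k ≡ coeffU q k

InT : UPoly → Set
InT p = (coeffU p 0 ≡ 0) × (∃[ k ] ¬ (coeffU p k ≡ 0))

SizeT≤ : UPoly → ℕ → Set
SizeT≤ p c = ∀ k → (c < k → coeffU p k ≡ 0) × (coeffU p k ≤ c)

-- A monomial is an exponent list (entry i = exponent of x_{i+1}),
-- trailing zeros irrelevant; a polynomial is a list of terms
-- (coefficient , monomial).

Mon : Set
Mon = List ℕ

strip : Mon → Mon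
strip []       = []
strip (x ∷ xs) with strip xs | x
... | [] | zero  = []
... | ys | x'    = x' ∷ ys

IPoly : Set
IPoly = List (ℕ × Mon)

coeffI : IPoly → Mon → ℕ
coeffI []             μ = 0
coeffI ((c , e) ∷ p)  μ with ListP.≡-dec _≟_ (strip e) (strip μ)
... | yes _ = c + coeffI p μ
... | no  _ = coeffI p μ

mulI : IPoly → IPoly → IPoly
mulI p q = concatMap (λ { (c , e) → map (λ { (d , f) → (c * d , addU e f) }) q }) p

_≈I_ : IPoly → IPoly → Set
p ≈I q = ∀ μ → coeffI p μ ≡ coeffI q μ

InP∞ : IPoly → Set
InP∞ p = (coeffI p [] ≡ 0) × (∃[ μ ] ¬ (coeffI p μ ≡ 0))

MPoly : ℕ → Set
MPoly m = List (ℕ × Vec ℕ m)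

coeffM : ∀ {m} → MPoly m → Vec ℕ m → ℕ
coeffM []            μ = 0
coeffM ((c , e) ∷ p) μ with VecP.≡-dec _≟_ e μ
... | yes _ = c + coeffM p μ
... | no  _ = coeffM p μ

-- good: nonnegative integer coefficients (built in) and zero constant term
Good : ∀ {m} → MPoly m → Set
Good {m} F = coeffM F (replicate m 0) ≡ 0

record Alg : Set₁ where
  field
    Carrier : Set
    0#      : Carrier
    1#      : Carrier
    _⊕_     : Carrier → Carrier → Carrier
    _⊗_     : Carrier → Carrier → Carrier

module _ (A : Alg) where
  open Alg A

  cst : ℕ → Carrier
  cst zero    = 0#
  cst (suc c) = 1# ⊕ cst c

  pow : Carrier → ℕ → Carrier
  pow x zero    = 1#
  pow x (suc k) = x ⊗ pow x k

  monoEval : ∀ {m} → Vec ℕ m → Vec Carrier m → Carrier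
  monoEval []       []       = 1#
  monoEval (e ∷ es) (x ∷ xs) = pow x e ⊗ monoEval es xs

  evalM : ∀ {m} → MPoly m → Vec Carrier m → Carrier
  evalM []            a = 0#
  evalM ((c , e) ∷ F) a = (cst c ⊗ monoEval e a) ⊕ evalM F a

algT : Alg
algT = record { Carrier = UPoly ; 0# = [] ; 1# = 1 ∷ [] ; _⊕_ = addU ; _⊗_ = mulU }

algP∞ : Alg
algP∞ = record { Carrier = IPoly ; 0# = [] ; 1# = (1 , []) ∷ [] ; _⊕_ = _++_ ; _⊗_ = mulI }

algℕ : Alg
algℕ = record { Carrier = ℕ ; 0# = 0 ; 1# = 1 ; _⊕_ = _+_ ; _⊗_ = _*_ }

record Domain : Set₁ where
  field
    alg  : Alg
    _≈_  : Alg.Carrier alg → Alg.Carrier alg → Set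
    In   : Alg.Carrier alg → Set
  open Alg alg public

domT : Domain
domT = record { alg = algT ; _≈_ = _≈U_ ; In = InT }

domP∞ : Domain
domP∞ = record { alg = algP∞ ; _≈_ = _≈I_ ; In = InP∞ }

domℕ : Domain
domℕ = record { alg = algℕ ; _≈_ = _≡_ ; In = λ x → 1 ≤ x }

module _ (D : Domain) where
  open Domain D

  Coloring : ℕ → Set
  Coloring n = Σ ((x : Carrier) → In x → Fin n) λ χ →
    ∀ x y (px : In x) (py : In y) → x ≈ y → χ x px ≡ χ y py

  MonoInstance : ∀ {m r n} → Vec (MPoly m) r → Coloring n →
                 Vec Carrier m → Fin n → Set
  MonoInstance {m} {r} F (χ , _) a c =
    (∀ (i : Fin m) → In (lookup a i)) ×
    (∀ (j : Fin r) → Σ (In (evalM alg (lookup F j) a)) λ p →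
       χ (evalM alg (lookup F j) a) p ≡ c)

  PartitionRegular : ∀ {m r} → Vec (MPoly m) r → Set
  PartitionRegular {m} F = ∀ n (χ : Coloring n) →
    ∃[ a ] ∃[ c ] MonoInstance F χ a c

data PRF : ℕ → Set where
  cZ : ∀ {k} → PRF k
  cS : PRF 1
  cP : ∀ {k} → Fin k → PRF k
  cC : ∀ {k l} → PRF l → Vec (PRF k) l → PRF k
  cR : ∀ {k} → PRF k → PRF (suc (suc k)) → PRF (suc k)

mutual
  ⟦_⟧ : ∀ {k} → PRF k → Vec ℕ k → ℕ
  ⟦ cZ ⟧     xs           = 0
  ⟦ cS ⟧     (x ∷ [])     = suc x
  ⟦ cP i ⟧   xs           = lookup xs i
  ⟦ cC f gs ⟧ xs          = ⟦ f ⟧ (⟦ gs ⟧* xs)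
  ⟦ cR g h ⟧ (n ∷ xs)     = recPR g h n xs

  ⟦_⟧* : ∀ {k l} → Vec (PRF k) l → Vec ℕ k → Vec ℕ l
  ⟦ [] ⟧*     xs = []
  ⟦ g ∷ gs ⟧* xs = ⟦ g ⟧ xs ∷ ⟦ gs ⟧* xs

  recPR : ∀ {k} → PRF k → PRF (suc (suc k)) → ℕ → Vec ℕ k → ℕ
  recPR g h zero    xs = ⟦ g ⟧ xs
  recPR g h (suc n) xs = ⟦ h ⟧ (n ∷ recPR g h n xs ∷ xs)

PrimRec : (ℕ → ℕ) → Set
PrimRec N = Σ (PRF 1) λ f → ∀ n → ⟦ f ⟧ (n ∷ []) ≡ N n

PRT-bounded : ∀ {m r} → Vec (MPoly m) r → Set
PRT-bounded {m} {r} F = Σ (ℕ → ℕ) λ N → PrimRec N ×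
  (∀ n (χ : Coloring domT n) → ∃[ a ] ∃[ c ]
     MonoInstance domT F χ a c ×
     (∀ (j : Fin r) → SizeT≤ (evalM algT (lookup F j) a) (N n)))

ColoringUpTo : ℕ → ℕ → Set
ColoringUpTo M n = (x : ℕ) → 1 ≤ x → x ≤ M → Fin n

PRℕ-bounded : ∀ {m r} → Vec (MPoly m) r → Set
PRℕ-bounded {m} {r} F = Σ (ℕ → ℕ) λ N → PrimRec N ×
  (∀ n (χ : ColoringUpTo (N n) n) → ∃[ a ] ∃[ c ]
     (∀ (i : Fin m) → 1 ≤ lookup a i) ×
     (∀ (j : Fin r) → Σ (1 ≤ evalM algℕ (lookup F j) a) λ p →
        Σ (evalM algℕ (lookup F j) a ≤ N n) λ q →
          χ (evalM algℕ (lookup F j) a) p q ≡ c))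

-- The three substitutions  xᵢ ↦ t : P∞ → T,  t ↦ x₁ : T → P∞  and  t ↦ 1 : T → ℕ  are semiring
-- homomorphisms that send nonzero good polynomials to nonzero good polynomials (resp. positive integers) and
-- respect equality of polynomials. So each commutes with evaluating the pattern, a colouring of the target pulls
-- back to a colouring of the source, and a monochromatic instance in the source is pushed forward to one in the
-- target. The delicate points are that xᵢ ↦ t respects equality although equal monomials may be scattered over a
-- term list, and that t ↦ x₁ respects equality, which holds because xᵢ ↦ t is injective on polynomials in x₁
-- alone. For the bounds: a polynomial of size at most c has at most c + 1 coefficients, each at most c, so its
-- value at 1 is at most (c + 1)².

module Submission where

open import Defs
open import Data.Nat using (ℕ; zero; suc; _+_; _*_; _≤_; _≟_; z≤n; s≤s; s≤s⁻¹; _≤?_)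
open import Data.Nat.Properties
open import Data.Fin using (Fin) renaming (zero to fzero; suc to fsuc)
import Data.Vec as Vec
open import Data.List using ([]; _∷_; _++_; length; map; filter)
open import Data.Nat.ListAction using (sum)
open import Data.Vec using (Vec; []; _∷_; lookup)
import Data.Vec.Properties as VecP
import Data.List.Properties as ListP
open import Data.List.Relation.Unary.All using (All; []; _∷_)
import Data.List.Relation.Unary.All.Properties as AllP
open import Data.Vec.Relation.Binary.Pointwise.Inductive using (Pointwise; []; _∷_)
open import Data.Product using (_×_; _,_; proj₁; proj₂)
open import Relation.Binary.PropositionalEquality
open import Relation.Nullary using (¬_; ¬?; Dec; contradiction; yes; no)
open import Function.Base using (_∘_; case_of_)
open import Function.Bundles using (_⇔_; mk⇔)
open import Algebra.Properties.CommutativeSemigroup +-commutativeSemigroup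
  using (interchange; x∙yz≈y∙xz)

record Morphism (D E : Domain) : Set where
  private
    module D = Domain D
    module E = Domain E
  field
    fun       : D.Carrier → E.Carrier
    fun-In    : ∀ {x} → D.In x → E.In (fun x)
    fun-cong  : ∀ {x y} → x D.≈ y → fun x E.≈ fun y
    fun-evalM : ∀ {m} (F : MPoly m) a →
                evalM E.alg F (Vec.map fun a) E.≈ fun (evalM D.alg F a)

In-closed : Domain → Set
In-closed D = ∀ x y → x ≈ y → In y → In x
  where open Domain D

module _ {D E : Domain} (φ : Morphism D E) where
  open Morphism φ

  pullback : ∀ {n} → Coloring E n → Coloring D n
  pullback (χ , χ-resp) =
    (λ x x∈D → χ (fun x) (fun-In x∈D)) ,
    (λ x y x∈D y∈D x≈y → χ-resp _ _ _ _ (fun-cong x≈y))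

  push-MonoInstance : In-closed E → ∀ {m r n} (F : Vec (MPoly m) r) (χ : Coloring E n) {a c} →
    MonoInstance D F (pullback χ) a c → MonoInstance E F χ (Vec.map fun a) c
  push-MonoInstance In-cl F (χ , χ-resp) {a} (a∈D , Fa∈D) =
    (λ i → subst (Domain.In E) (sym (VecP.lookup-map i fun a)) (fun-In (a∈D i))) ,
    λ j → let (Fja∈D , colour) = Fa∈D j
              eq = fun-evalM (lookup F j) a
              Fj∈E = In-cl _ _ eq (fun-In Fja∈D)
          in Fj∈E , trans (χ-resp _ _ Fj∈E (fun-In Fja∈D) eq) colour

  PartitionRegular-transfer : In-closed E → ∀ {m r} (F : Vec (MPoly m) r) →
    PartitionRegular D F → PartitionRegular E F
  PartitionRegular-transfer In-cl F prD n χ =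
    let (a , c , inst) = prD n (pullback χ)
    in Vec.map fun a , c , push-MonoInstance In-cl F χ inst

In-closed-T : In-closed domT
In-closed-T x y x≈y (y₀≡0 , k , yₖ≢0) =
  trans (x≈y 0) y₀≡0 , k , λ xₖ≡0 → yₖ≢0 (trans (sym (x≈y k)) xₖ≡0)

In-closed-P∞ : In-closed domP∞
In-closed-P∞ x y x≈y (y₀≡0 , μ , yμ≢0) =
  trans (x≈y []) y₀≡0 , μ , λ xμ≡0 → yμ≢0 (trans (sym (x≈y μ)) xμ≡0)

In-closed-ℕ : In-closed domℕ
In-closed-ℕ x y x≡y = subst (1 ≤_) (sym x≡y)

record Simulation (A B : Alg) : Set₁ where
  private
    module A = Alg A
    module B = Alg B
  field
    _∼_ : A.Carrier → B.Carrier → Set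
    0∼0 : A.0# ∼ B.0#
    1∼1 : A.1# ∼ B.1#
    ⊕-pres : ∀ {x x′ y y′} → x ∼ x′ → y ∼ y′ → (x A.⊕ y) ∼ (x′ B.⊕ y′)
    ⊗-pres : ∀ {x x′ y y′} → x ∼ x′ → y ∼ y′ → (x A.⊗ y) ∼ (x′ B.⊗ y′)

module _ {A B : Alg} (S : Simulation A B) where
  open Simulation S

  cst-sim : ∀ c → cst A c ∼ cst B c
  cst-sim zero    = 0∼0
  cst-sim (suc c) = ⊕-pres 1∼1 (cst-sim c)

  pow-sim : ∀ {x y} → x ∼ y → ∀ k → pow A x k ∼ pow B y k
  pow-sim x∼y zero    = 1∼1
  pow-sim x∼y (suc k) = ⊗-pres x∼y (pow-sim x∼y k)

  monoEval-sim : ∀ {m} (e : Vec ℕ m) {a b} → Pointwise _∼_ a b → monoEval A e a ∼ monoEval B e b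
  monoEval-sim []      []          = 1∼1
  monoEval-sim (k ∷ e) (x∼y ∷ a∼b) = ⊗-pres (pow-sim x∼y k) (monoEval-sim e a∼b)

  evalM-sim : ∀ {m} (F : MPoly m) {a b} → Pointwise _∼_ a b → evalM A F a ∼ evalM B F b
  evalM-sim []            a∼b = 0∼0
  evalM-sim ((c , e) ∷ F) a∼b = ⊕-pres (⊗-pres (cst-sim c) (monoEval-sim e a∼b)) (evalM-sim F a∼b)

  evalM-sim-map : ∀ (f : Alg.Carrier B → Alg.Carrier A) → (∀ x → f x ∼ x) →
    ∀ {m} (F : MPoly m) a → evalM A F (Vec.map f a) ∼ evalM B F a
  evalM-sim-map f f∼id F a = evalM-sim F (map-related a)
    where
      map-related : ∀ {m} (a : Vec (Alg.Carrier B) m) → Pointwise _∼_ (Vec.map f a) a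
      map-related []      = []
      map-related (x ∷ a) = f∼id x ∷ map-related a

coeffU-addU : ∀ p q k → coeffU (addU p q) k ≡ coeffU p k + coeffU q k
coeffU-addU []      q       k       = refl
coeffU-addU (a ∷ p) []      k       = sym (+-identityʳ _)
coeffU-addU (a ∷ p) (b ∷ q) zero    = refl
coeffU-addU (a ∷ p) (b ∷ q) (suc k) = coeffU-addU p q k

coeffU-scale : ∀ a q k → coeffU (map (a *_) q) k ≡ a * coeffU q k
coeffU-scale a []      k       = sym (*-zeroʳ a)
coeffU-scale a (b ∷ q) zero    = refl
coeffU-scale a (b ∷ q) (suc k) = coeffU-scale a q k

coeffU-mulU-∷ : ∀ a p q k → coeffU (mulU (a ∷ p) q) k ≡ a * coeffU q k + coeffU (0 ∷ mulU p q) k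
coeffU-mulU-∷ a p q k =
  trans (coeffU-addU (map (a *_) q) (0 ∷ mulU p q) k) (cong (_+ coeffU (0 ∷ mulU p q) k) (coeffU-scale a q k))

∷-cong : ∀ a {p q} → p ≈U q → (a ∷ p) ≈U (a ∷ q)
∷-cong a p≈q zero    = refl
∷-cong a p≈q (suc k) = p≈q k

0∷-zero : ∀ {p} → p ≈U [] → (0 ∷ p) ≈U []
0∷-zero p≈0 zero    = refl
0∷-zero p≈0 (suc k) = p≈0 k

addU-cong : ∀ {p p′ q q′} → p ≈U p′ → q ≈U q′ → addU p q ≈U addU p′ q′
addU-cong {p} {p′} {q} {q′} p≈p′ q≈q′ k = begin
  coeffU (addU p q) k       ≡⟨ coeffU-addU p q k ⟩
  coeffU p k + coeffU q k   ≡⟨ cong₂ _+_ (p≈p′ k) (q≈q′ k) ⟩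
  coeffU p′ k + coeffU q′ k ≡⟨ coeffU-addU p′ q′ k ⟨
  coeffU (addU p′ q′) k     ∎
  where open ≡-Reasoning

mulU-zeroˡ : ∀ p q → p ≈U [] → mulU p q ≈U []
mulU-zeroˡ []      q p≈0 k = refl
mulU-zeroˡ (a ∷ p) q p≈0 k = trans (coeffU-mulU-∷ a p q k)
  (cong₂ _+_ (cong (_* coeffU q k) (p≈0 0)) (0∷-zero (mulU-zeroˡ p q (p≈0 ∘ suc)) k))

mulU-zeroʳ : ∀ p → mulU p [] ≈U []
mulU-zeroʳ []      k = refl
mulU-zeroʳ (a ∷ p) k = trans (coeffU-mulU-∷ a p [] k) (cong₂ _+_ (*-zeroʳ a) (0∷-zero (mulU-zeroʳ p) k))

mulU-congˡ : ∀ p p′ q → p ≈U p′ → mulU p q ≈U mulU p′ q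
mulU-congˡ []      []       q p≈p′ k = refl
mulU-congˡ []      (b ∷ p′) q p≈p′ k = sym (mulU-zeroˡ (b ∷ p′) q (sym ∘ p≈p′) k)
mulU-congˡ (a ∷ p) []       q p≈p′   = mulU-zeroˡ (a ∷ p) q p≈p′
mulU-congˡ (a ∷ p) (b ∷ p′) q p≈p′ k = begin
  coeffU (mulU (a ∷ p) q) k                   ≡⟨ coeffU-mulU-∷ a p q k ⟩
  a * coeffU q k + coeffU (0 ∷ mulU p q) k    ≡⟨ cong₂ _+_ (cong (_* coeffU q k) (p≈p′ 0))
                                                           (∷-cong 0 (mulU-congˡ p p′ q (p≈p′ ∘ suc)) k) ⟩
  b * coeffU q k + coeffU (0 ∷ mulU p′ q) k   ≡⟨ coeffU-mulU-∷ b p′ q k ⟨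
  coeffU (mulU (b ∷ p′) q) k                  ∎
  where open ≡-Reasoning

mulU-congʳ : ∀ p {q q′} → q ≈U q′ → mulU p q ≈U mulU p q′
mulU-congʳ []      q≈q′ k = refl
mulU-congʳ (a ∷ p) {q} {q′} q≈q′ k = begin
  coeffU (mulU (a ∷ p) q) k                   ≡⟨ coeffU-mulU-∷ a p q k ⟩
  a * coeffU q k + coeffU (0 ∷ mulU p q) k    ≡⟨ cong₂ _+_ (cong (a *_) (q≈q′ k)) (∷-cong 0 (mulU-congʳ p q≈q′) k) ⟩
  a * coeffU q′ k + coeffU (0 ∷ mulU p q′) k  ≡⟨ coeffU-mulU-∷ a p q′ k ⟨
  coeffU (mulU (a ∷ p) q′) k                  ∎
  where open ≡-Reasoning

mulU-cong : ∀ {p p′ q q′} → p ≈U p′ → q ≈U q′ → mulU p q ≈U mulU p′ q′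
mulU-cong {p} {p′} {q} p≈p′ q≈q′ k = trans (mulU-congˡ p p′ q p≈p′ k) (mulU-congʳ p′ q≈q′ k)

-- 0 ∷ addU r s is definitionally addU (0 ∷ r) (0 ∷ s), so the induction hypothesis applies under the shift.
mulU-distribʳ-addU : ∀ p p′ q → mulU (addU p p′) q ≈U addU (mulU p q) (mulU p′ q)
mulU-distribʳ-addU []      p′       q k = refl
mulU-distribʳ-addU (a ∷ p) []       q k = sym (trans (coeffU-addU (mulU (a ∷ p) q) [] k) (+-identityʳ _))
mulU-distribʳ-addU (a ∷ p) (b ∷ p′) q k = begin
  coeffU (mulU (a + b ∷ addU p p′) q) k
    ≡⟨ coeffU-mulU-∷ (a + b) (addU p p′) q k ⟩
  (a + b) * qₖ + coeffU (0 ∷ mulU (addU p p′) q) k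
    ≡⟨ cong₂ _+_ (*-distribʳ-+ qₖ a b)
                 (trans (∷-cong 0 (mulU-distribʳ-addU p p′ q) k) (coeffU-addU (0 ∷ mulU p q) (0 ∷ mulU p′ q) k)) ⟩
  (a * qₖ + b * qₖ) + (coeffU (0 ∷ mulU p q) k + coeffU (0 ∷ mulU p′ q) k)
    ≡⟨ interchange (a * qₖ) (b * qₖ) _ _ ⟩
  (a * qₖ + coeffU (0 ∷ mulU p q) k) + (b * qₖ + coeffU (0 ∷ mulU p′ q) k)
    ≡⟨ cong₂ _+_ (coeffU-mulU-∷ a p q k) (coeffU-mulU-∷ b p′ q k) ⟨
  coeffU (mulU (a ∷ p) q) k + coeffU (mulU (b ∷ p′) q) k
    ≡⟨ coeffU-addU (mulU (a ∷ p) q) (mulU (b ∷ p′) q) k ⟨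
  coeffU (addU (mulU (a ∷ p) q) (mulU (b ∷ p′) q)) k ∎
  where open ≡-Reasoning
        qₖ = coeffU q k

mulU-distribˡ-addU : ∀ p q q′ → mulU p (addU q q′) ≈U addU (mulU p q) (mulU p q′)
mulU-distribˡ-addU []      q q′ k = refl
mulU-distribˡ-addU (a ∷ p) q q′ k = begin
  coeffU (mulU (a ∷ p) (addU q q′)) k
    ≡⟨ coeffU-mulU-∷ a p (addU q q′) k ⟩
  a * coeffU (addU q q′) k + coeffU (0 ∷ mulU p (addU q q′)) k
    ≡⟨ cong₂ _+_ (trans (cong (a *_) (coeffU-addU q q′ k)) (*-distribˡ-+ a qₖ q′ₖ))
                 (trans (∷-cong 0 (mulU-distribˡ-addU p q q′) k) (coeffU-addU (0 ∷ mulU p q) (0 ∷ mulU p q′) k)) ⟩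
  (a * qₖ + a * q′ₖ) + (coeffU (0 ∷ mulU p q) k + coeffU (0 ∷ mulU p q′) k)
    ≡⟨ interchange (a * qₖ) (a * q′ₖ) _ _ ⟩
  (a * qₖ + coeffU (0 ∷ mulU p q) k) + (a * q′ₖ + coeffU (0 ∷ mulU p q′) k)
    ≡⟨ cong₂ _+_ (coeffU-mulU-∷ a p q k) (coeffU-mulU-∷ a p q′ k) ⟨
  coeffU (mulU (a ∷ p) q) k + coeffU (mulU (a ∷ p) q′) k
    ≡⟨ coeffU-addU (mulU (a ∷ p) q) (mulU (a ∷ p) q′) k ⟨
  coeffU (addU (mulU (a ∷ p) q) (mulU (a ∷ p) q′)) k ∎
  where open ≡-Reasoning
        qₖ = coeffU q k
        q′ₖ = coeffU q′ k

monoU : ℕ → ℕ → UPoly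
monoU c zero    = c ∷ []
monoU c (suc a) = 0 ∷ monoU c a

coeffU-monoU-≡ : ∀ c a → coeffU (monoU c a) a ≡ c
coeffU-monoU-≡ c zero    = refl
coeffU-monoU-≡ c (suc a) = coeffU-monoU-≡ c a

coeffU-monoU-≢ : ∀ c {a k} → a ≢ k → coeffU (monoU c a) k ≡ 0
coeffU-monoU-≢ c {zero}  {zero}  a≢k = contradiction refl a≢k
coeffU-monoU-≢ c {zero}  {suc k} a≢k = refl
coeffU-monoU-≢ c {suc a} {zero}  a≢k = refl
coeffU-monoU-≢ c {suc a} {suc k} a≢k = coeffU-monoU-≢ c (a≢k ∘ cong suc)

coeffU-monoU-+ : ∀ c d a k → coeffU (monoU (c + d) a) k ≡ coeffU (monoU c a) k + coeffU (monoU d a) k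
coeffU-monoU-+ c d zero    zero    = refl
coeffU-monoU-+ c d zero    (suc k) = refl
coeffU-monoU-+ c d (suc a) zero    = refl
coeffU-monoU-+ c d (suc a) (suc k) = coeffU-monoU-+ c d a k

coeffU-monoU-* : ∀ c d a k → coeffU (monoU (c * d) a) k ≡ c * coeffU (monoU d a) k
coeffU-monoU-* c d zero    zero    = refl
coeffU-monoU-* c d zero    (suc k) = sym (*-zeroʳ c)
coeffU-monoU-* c d (suc a) zero    = sym (*-zeroʳ c)
coeffU-monoU-* c d (suc a) (suc k) = coeffU-monoU-* c d a k

monoU-zero : ∀ a → monoU 0 a ≈U []
monoU-zero a = coeffU-monoU-* 0 0 a

coeffU-mulU-const : ∀ c q k → coeffU (mulU (c ∷ []) q) k ≡ c * coeffU q k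
coeffU-mulU-const c q k =
  trans (coeffU-mulU-∷ c [] q k) (trans (cong (c * coeffU q k +_) (0∷-zero (λ _ → refl) k)) (+-identityʳ _))

mulU-monoU : ∀ c a d b → mulU (monoU c a) (monoU d b) ≈U monoU (c * d) (a + b)
mulU-monoU c zero    d b k = trans (coeffU-mulU-const c (monoU d b) k) (sym (coeffU-monoU-* c d b k))
mulU-monoU c (suc a) d b k = trans (coeffU-mulU-∷ 0 (monoU c a) (monoU d b) k) (∷-cong 0 (mulU-monoU c a d b) k)

-- Evaluation at t = 1

sum-addU : ∀ p q → sum (addU p q) ≡ sum p + sum q
sum-addU []      q       = refl
sum-addU (a ∷ p) []      = sym (+-identityʳ _)
sum-addU (a ∷ p) (b ∷ q) = trans (cong (a + b +_) (sum-addU p q)) (interchange a b (sum p) (sum q))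

sum-scale : ∀ a q → sum (map (a *_) q) ≡ a * sum q
sum-scale a []      = sym (*-zeroʳ a)
sum-scale a (b ∷ q) = trans (cong (a * b +_) (sum-scale a q)) (sym (*-distribˡ-+ a b (sum q)))

sum-mulU : ∀ p q → sum (mulU p q) ≡ sum p * sum q
sum-mulU []      q = refl
sum-mulU (a ∷ p) q = begin
  sum (addU (map (a *_) q) (0 ∷ mulU p q)) ≡⟨ sum-addU (map (a *_) q) (0 ∷ mulU p q) ⟩
  sum (map (a *_) q) + sum (mulU p q)      ≡⟨ cong₂ _+_ (sum-scale a q) (sum-mulU p q) ⟩
  a * sum q + sum p * sum q                ≡⟨ *-distribʳ-+ (sum q) a (sum p) ⟨
  (a + sum p) * sum q                      ∎
  where open ≡-Reasoning

sum-cong : ∀ p q → p ≈U q → sum p ≡ sum q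
sum-cong []      []      p≈q = refl
sum-cong []      (b ∷ q) p≈q = cong₂ _+_ (p≈q 0) (sum-cong [] q (p≈q ∘ suc))
sum-cong (a ∷ p) []      p≈q = cong₂ _+_ (p≈q 0) (sum-cong p [] (p≈q ∘ suc))
sum-cong (a ∷ p) (b ∷ q) p≈q = cong₂ _+_ (p≈q 0) (sum-cong p q (p≈q ∘ suc))

coeffU≤sum : ∀ p k → coeffU p k ≤ sum p
coeffU≤sum []      k       = z≤n
coeffU≤sum (a ∷ p) zero    = m≤m+n a (sum p)
coeffU≤sum (a ∷ p) (suc k) = ≤-trans (coeffU≤sum p k) (m≤n+m (sum p) a)

sum-positive : ∀ p → InT p → 1 ≤ sum p
sum-positive p (_ , k , pₖ≢0) = ≤-trans (n≢0⇒n>0 pₖ≢0) (coeffU≤sum p k)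

sum-simulation : Simulation algℕ algT
sum-simulation = record
  { _∼_    = λ n p → n ≡ sum p
  ; 0∼0    = refl
  ; 1∼1    = refl
  ; ⊕-pres = λ {_} {p} {_} {q} n≡ m≡ → trans (cong₂ _+_ n≡ m≡) (sym (sum-addU p q))
  ; ⊗-pres = λ {_} {p} {_} {q} n≡ m≡ → trans (cong₂ _*_ n≡ m≡) (sym (sum-mulU p q))
  }

sum-Morphism : Morphism domT domℕ
sum-Morphism = record
  { fun       = sum
  ; fun-In    = λ {p} → sum-positive p
  ; fun-cong  = λ {p} {q} → sum-cong p q
  ; fun-evalM = evalM-sim-map sum-simulation sum (λ _ → refl)
  }

-- Substituting t for every variable

_≃_ : Mon → Mon → Set
e ≃ μ = strip e ≡ strip μ

-- Literally the test in coeffI, so that case analysis on e ≃? μ also reduces coeffI.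
_≃?_ : ∀ e μ → Dec (e ≃ μ)
e ≃? μ = ListP.≡-dec _≟_ (strip e) (strip μ)

coeffI-∷-≄ : ∀ c e p μ → ¬ e ≃ μ → coeffI ((c , e) ∷ p) μ ≡ coeffI p μ
coeffI-∷-≄ c e p μ e≄μ with e ≃? μ
... | yes e≃μ = contradiction e≃μ e≄μ
... | no  _   = refl

coeffI-∷-cong : ∀ t {p q μ} → coeffI p μ ≡ coeffI q μ → coeffI (t ∷ p) μ ≡ coeffI (t ∷ q) μ
coeffI-∷-cong (c , e) {μ = μ} eq with e ≃? μ
... | yes _ = cong (c +_) eq
... | no  _ = eq

sum-strip : ∀ e → sum (strip e) ≡ sum e
sum-strip []       = refl
sum-strip (x ∷ xs) with strip xs | sum-strip xs | x
... | []     | ih | zero   = ih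
... | []     | ih | suc x′ = cong (suc x′ +_) ih
... | y ∷ ys | ih | x′     = cong (x′ +_) ih

length-strip : ∀ e → length (strip e) ≤ length e
length-strip []       = z≤n
length-strip (x ∷ xs) with strip xs | length-strip xs | x
... | []     | ih | zero   = z≤n
... | []     | ih | suc x′ = s≤s z≤n
... | y ∷ ys | ih | x′     = s≤s ih

strip-idem : ∀ e → strip (strip e) ≡ strip e
strip-idem []       = refl
strip-idem (x ∷ xs) with strip xs | strip-idem xs | x
... | []     | ih | zero   = refl
... | []     | ih | suc x′ = refl
... | y ∷ ys | ih | x′     rewrite ih = refl

sum≡0⇒≃[] : ∀ e → sum e ≡ 0 → e ≃ []
sum≡0⇒≃[] []       _  = refl
sum≡0⇒≃[] (x ∷ xs) eq with strip xs | sum≡0⇒≃[] xs (m+n≡0⇒n≡0 x eq) | x | m+n≡0⇒m≡0 x eq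
... | .[] | refl | .zero | refl = refl

≃⇒sum≡ : ∀ e μ → e ≃ μ → sum e ≡ sum μ
≃⇒sum≡ e μ e≃μ = trans (sym (sum-strip e)) (trans (cong sum e≃μ) (sum-strip μ))

-- On a monomial, sum is its total degree.
collapse : IPoly → UPoly
collapse []            = []
collapse ((c , e) ∷ p) = addU (monoU c (sum e)) (collapse p)

coeffU-collapse-∷ : ∀ c e p k →
  coeffU (collapse ((c , e) ∷ p)) k ≡ coeffU (monoU c (sum e)) k + coeffU (collapse p) k
coeffU-collapse-∷ c e p = coeffU-addU (monoU c (sum e)) (collapse p)

coeffU-monoU-≃ : ∀ c e μ → e ≃ μ → coeffU (monoU c (sum e)) (sum μ) ≡ c
coeffU-monoU-≃ c e μ e≃μ =
  trans (cong (λ s → coeffU (monoU c s) (sum μ)) (≃⇒sum≡ e μ e≃μ)) (coeffU-monoU-≡ c (sum μ))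

collapse-++ : ∀ p q → collapse (p ++ q) ≈U addU (collapse p) (collapse q)
collapse-++ []            q k = refl
collapse-++ ((c , e) ∷ p) q k = begin
  coeffU (collapse ((c , e) ∷ p ++ q)) k         ≡⟨ coeffU-collapse-∷ c e (p ++ q) k ⟩
  Mₖ + coeffU (collapse (p ++ q)) k              ≡⟨ cong (Mₖ +_) (trans (collapse-++ p q k) (coeffU-addU P Q k)) ⟩
  Mₖ + (coeffU P k + coeffU Q k)                 ≡⟨ +-assoc Mₖ (coeffU P k) (coeffU Q k) ⟨
  (Mₖ + coeffU P k) + coeffU Q k                 ≡⟨ cong (_+ coeffU Q k) (coeffU-collapse-∷ c e p k) ⟨
  coeffU (collapse ((c , e) ∷ p)) k + coeffU Q k ≡⟨ coeffU-addU (collapse ((c , e) ∷ p)) Q k ⟨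
  coeffU (addU (collapse ((c , e) ∷ p)) Q) k     ∎
  where open ≡-Reasoning
        Mₖ = coeffU (monoU c (sum e)) k
        P = collapse p
        Q = collapse q

mulI-∷ : ∀ t p q → mulI (t ∷ p) q ≡ mulI (t ∷ []) q ++ mulI p q
mulI-∷ t p q = cong (_++ mulI p q) (sym (ListP.++-identityʳ _))

collapse-mulI-term : ∀ c e q → collapse (mulI ((c , e) ∷ []) q) ≈U mulU (monoU c (sum e)) (collapse q)
collapse-mulI-term c e []            = λ k → sym (mulU-zeroʳ (monoU c (sum e)) k)
collapse-mulI-term c e ((d , f) ∷ q) k = begin
  coeffU (collapse ((c * d , addU e f) ∷ mulI ((c , e) ∷ []) q)) k
    ≡⟨ coeffU-collapse-∷ (c * d) (addU e f) (mulI ((c , e) ∷ []) q) k ⟩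
  coeffU (monoU (c * d) (sum (addU e f))) k + coeffU (collapse (mulI ((c , e) ∷ []) q)) k
    ≡⟨ cong₂ _+_ (trans (cong (λ s → coeffU (monoU (c * d) s) k) (sum-addU e f))
                        (sym (mulU-monoU c (sum e) d (sum f) k)))
                 (collapse-mulI-term c e q k) ⟩
  coeffU (mulU M (monoU d (sum f))) k + coeffU (mulU M (collapse q)) k
    ≡⟨ coeffU-addU (mulU M (monoU d (sum f))) (mulU M (collapse q)) k ⟨
  coeffU (addU (mulU M (monoU d (sum f))) (mulU M (collapse q))) k
    ≡⟨ mulU-distribˡ-addU M (monoU d (sum f)) (collapse q) k ⟨
  coeffU (mulU M (collapse ((d , f) ∷ q))) k ∎
  where open ≡-Reasoning
        M = monoU c (sum e)

collapse-mulI : ∀ p q → collapse (mulI p q) ≈U mulU (collapse p) (collapse q)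
collapse-mulI []            q k = refl
collapse-mulI ((c , e) ∷ p) q k = begin
  coeffU (collapse (mulI ((c , e) ∷ p) q)) k
    ≡⟨ cong (λ r → coeffU (collapse r) k) (mulI-∷ (c , e) p q) ⟩
  coeffU (collapse (mulI ((c , e) ∷ []) q ++ mulI p q)) k
    ≡⟨ collapse-++ (mulI ((c , e) ∷ []) q) (mulI p q) k ⟩
  coeffU (addU (collapse (mulI ((c , e) ∷ []) q)) (collapse (mulI p q))) k
    ≡⟨ addU-cong {collapse (mulI ((c , e) ∷ []) q)} {mulU M (collapse q)} {collapse (mulI p q)}
                 (collapse-mulI-term c e q) (collapse-mulI p q) k ⟩
  coeffU (addU (mulU M (collapse q)) (mulU (collapse p) (collapse q))) k
    ≡⟨ mulU-distribʳ-addU M (collapse p) (collapse q) k ⟨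
  coeffU (mulU (addU M (collapse p)) (collapse q)) k ∎
  where open ≡-Reasoning
        M = monoU c (sum e)

collapse-simulation : Simulation algT algP∞
collapse-simulation = record
  { _∼_    = λ y x → y ≈U collapse x
  ; 0∼0    = λ k → refl
  ; 1∼1    = λ k → refl
  ; ⊕-pres = λ {y} {x} {y′} {x′} y≈ y′≈ k →
      trans (addU-cong {y} {collapse x} {y′} {collapse x′} y≈ y′≈ k) (sym (collapse-++ x x′ k))
  ; ⊗-pres = λ {y} {x} {y′} {x′} y≈ y′≈ k →
      trans (mulU-cong {y} {collapse x} {y′} {collapse x′} y≈ y′≈ k) (sym (collapse-mulI x x′ k))
  }

coeffU-collapse-0 : ∀ p → coeffU (collapse p) 0 ≡ coeffI p []
coeffU-collapse-0 []            = refl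
coeffU-collapse-0 ((c , e) ∷ p) with e ≃? []
... | yes e≃[] = trans (coeffU-collapse-∷ c e p 0) (cong₂ _+_ (coeffU-monoU-≃ c e [] e≃[]) (coeffU-collapse-0 p))
... | no  e≄[] = trans (coeffU-collapse-∷ c e p 0)
                       (cong₂ _+_ (coeffU-monoU-≢ c (e≄[] ∘ sum≡0⇒≃[] e)) (coeffU-collapse-0 p))

coeffI≤coeffU-collapse : ∀ p μ → coeffI p μ ≤ coeffU (collapse p) (sum μ)
coeffI≤coeffU-collapse []            μ = z≤n
coeffI≤coeffU-collapse ((c , e) ∷ p) μ with e ≃? μ
... | yes e≃μ = subst (c + coeffI p μ ≤_) (sym (coeffU-collapse-∷ c e p (sum μ)))
                  (+-mono-≤ (≤-reflexive (sym (coeffU-monoU-≃ c e μ e≃μ))) (coeffI≤coeffU-collapse p μ))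
... | no  _   = subst (coeffI p μ ≤_) (sym (coeffU-collapse-∷ c e p (sum μ)))
                  (≤-trans (coeffI≤coeffU-collapse p μ) (m≤n+m _ _))

collapse-In : ∀ p → InP∞ p → InT (collapse p)
collapse-In p (p₀≡0 , μ , pμ≢0) =
  trans (coeffU-collapse-0 p) p₀≡0 ,
  sum μ , λ eq → pμ≢0 (n≤0⇒n≡0 (subst (coeffI p μ ≤_) eq (coeffI≤coeffU-collapse p μ)))

delete : Mon → IPoly → IPoly
delete μ = filter (λ t → ¬? (proj₂ t ≃? μ))

coeffI-delete-≃ : ∀ μ p {ν} → ν ≃ μ → coeffI (delete μ p) ν ≡ 0
coeffI-delete-≃ μ []            ν≃μ = refl
coeffI-delete-≃ μ ((c , e) ∷ p) {ν} ν≃μ with e ≃? μ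
... | yes _   = coeffI-delete-≃ μ p ν≃μ
... | no  e≄μ = trans (coeffI-∷-≄ c e (delete μ p) ν (λ e≃ν → e≄μ (trans e≃ν ν≃μ)))
                      (coeffI-delete-≃ μ p ν≃μ)

coeffI-delete-≄ : ∀ μ p {ν} → ¬ ν ≃ μ → coeffI (delete μ p) ν ≡ coeffI p ν
coeffI-delete-≄ μ []            ν≄μ = refl
coeffI-delete-≄ μ ((c , e) ∷ p) {ν} ν≄μ with e ≃? μ
... | yes e≃μ = trans (coeffI-delete-≄ μ p ν≄μ)
                      (sym (coeffI-∷-≄ c e p ν (λ e≃ν → ν≄μ (trans (sym e≃ν) e≃μ))))
... | no  _   = coeffI-∷-cong (c , e) (coeffI-delete-≄ μ p ν≄μ)

delete-cong : ∀ μ p q → p ≈I q → delete μ p ≈I delete μ q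
delete-cong μ p q p≈q ν with ν ≃? μ
... | yes ν≃μ = trans (coeffI-delete-≃ μ p ν≃μ) (sym (coeffI-delete-≃ μ q ν≃μ))
... | no  ν≄μ = trans (coeffI-delete-≄ μ p ν≄μ) (trans (p≈q ν) (sym (coeffI-delete-≄ μ q ν≄μ)))

collapse-delete : ∀ μ p → collapse p ≈U addU (monoU (coeffI p μ) (sum μ)) (collapse (delete μ p))
collapse-delete μ [] k =
  sym (trans (coeffU-addU (monoU 0 (sum μ)) [] k) (trans (+-identityʳ _) (monoU-zero (sum μ) k)))
collapse-delete μ ((c , e) ∷ p) k with e ≃? μ
... | yes e≃μ = begin
  coeffU (collapse ((c , e) ∷ p)) k      ≡⟨ coeffU-collapse-∷ c e p k ⟩
  Cₖ + coeffU (collapse p) k             ≡⟨ cong₂ _+_ (cong (λ s → coeffU (monoU c s) k) (≃⇒sum≡ e μ e≃μ))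
                                                      (trans (collapse-delete μ p k) (coeffU-addU M R k)) ⟩
  C′ₖ + (coeffU M k + coeffU R k)        ≡⟨ +-assoc C′ₖ (coeffU M k) (coeffU R k) ⟨
  (C′ₖ + coeffU M k) + coeffU R k        ≡⟨ cong (_+ coeffU R k) (coeffU-monoU-+ c (coeffI p μ) (sum μ) k) ⟨
  coeffU M′ k + coeffU R k               ≡⟨ coeffU-addU M′ R k ⟨
  coeffU (addU M′ R) k                   ∎
  where open ≡-Reasoning
        Cₖ = coeffU (monoU c (sum e)) k
        C′ₖ = coeffU (monoU c (sum μ)) k
        M = monoU (coeffI p μ) (sum μ)
        M′ = monoU (c + coeffI p μ) (sum μ)
        R = collapse (delete μ p)
... | no _ = begin
  coeffU (collapse ((c , e) ∷ p)) k      ≡⟨ coeffU-collapse-∷ c e p k ⟩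
  Cₖ + coeffU (collapse p) k             ≡⟨ cong (Cₖ +_) (trans (collapse-delete μ p k) (coeffU-addU M R k)) ⟩
  Cₖ + (coeffU M k + coeffU R k)         ≡⟨ x∙yz≈y∙xz Cₖ (coeffU M k) (coeffU R k) ⟩
  coeffU M k + (Cₖ + coeffU R k)         ≡⟨ cong (coeffU M k +_) (coeffU-collapse-∷ c e (delete μ p) k) ⟨
  coeffU M k + coeffU (collapse ((c , e) ∷ delete μ p)) k
                                         ≡⟨ coeffU-addU M (collapse ((c , e) ∷ delete μ p)) k ⟨
  coeffU (addU M (collapse ((c , e) ∷ delete μ p))) k ∎
  where open ≡-Reasoning
        Cₖ = coeffU (monoU c (sum e)) k
        M = monoU (coeffI p μ) (sum μ)
        R = collapse (delete μ p)

length-delete : ∀ μ p → length (delete μ p) ≤ length p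
length-delete μ = ListP.length-filter (λ t → ¬? (proj₂ t ≃? μ))

length-delete-head : ∀ c e p → length (delete e ((c , e) ∷ p)) ≤ length p
length-delete-head c e p with e ≃? e
... | yes _   = length-delete e p
... | no  e≄e = contradiction refl e≄e

collapse-cong-by-delete : ∀ μ p q → p ≈I q →
  collapse (delete μ p) ≈U collapse (delete μ q) → collapse p ≈U collapse q
collapse-cong-by-delete μ p q p≈q rest k = begin
  coeffU (collapse p) k                                   ≡⟨ collapse-delete μ p k ⟩
  coeffU (addU (Mono p) (collapse (delete μ p))) k        ≡⟨ addU-cong {Mono p} {Mono q} {collapse (delete μ p)}
                                                               (λ j → cong (λ c → coeffU (monoU c (sum μ)) j) (p≈q μ))
                                                               rest k ⟩
  coeffU (addU (Mono q) (collapse (delete μ q))) k        ≡⟨ collapse-delete μ q k ⟨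
  coeffU (collapse q) k                                   ∎
  where open ≡-Reasoning
        Mono = λ r → monoU (coeffI r μ) (sum μ)

-- Induction on the total number of terms: deleting the monomial of a head term from both sides
-- preserves ≈I and shortens the pair.
collapse-cong : ∀ p q → p ≈I q → collapse p ≈U collapse q
collapse-cong p q = go (length p + length q) p q ≤-refl
  where
    go : ∀ n p q → length p + length q ≤ n → p ≈I q → collapse p ≈U collapse q
    go n       []            []            _   _   k = refl
    go (suc n) ((c , e) ∷ p) q             len p≈q =
      collapse-cong-by-delete e ((c , e) ∷ p) q p≈q
        (go n (delete e ((c , e) ∷ p)) (delete e q)
            (≤-trans (+-mono-≤ (length-delete-head c e p) (length-delete e q)) (s≤s⁻¹ len))
            (delete-cong e ((c , e) ∷ p) q p≈q))
    go (suc n) []            ((d , f) ∷ q) len p≈q =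
      collapse-cong-by-delete f [] ((d , f) ∷ q) p≈q
        (go n [] (delete f ((d , f) ∷ q))
            (≤-trans (length-delete-head d f q) (s≤s⁻¹ len))
            (delete-cong f [] ((d , f) ∷ q) p≈q))

collapse-Morphism : Morphism domP∞ domT
collapse-Morphism = record
  { fun       = collapse
  ; fun-In    = λ {p} → collapse-In p
  ; fun-cong  = λ {p} {q} → collapse-cong p q
  ; fun-evalM = evalM-sim-map collapse-simulation collapse (λ _ _ → refl)
  }

-- Substituting x₁ for t

-- Exponent lists of length at most one: monomials in x₁ alone.
OneVar : Mon → Set
OneVar e = length e ≤ 1

OneVar⇒≃ : ∀ e → OneVar e → e ≃ (sum e ∷ [])
OneVar⇒≃ []          _ = refl
OneVar⇒≃ (k ∷ [])    _ = cong (λ s → strip (s ∷ [])) (sym (+-identityʳ k))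
OneVar⇒≃ (_ ∷ _ ∷ _) (s≤s ())

OneVar-strip⇒≃ : ∀ μ → OneVar (strip μ) → μ ≃ (sum μ ∷ [])
OneVar-strip⇒≃ μ μ1 = begin
  strip μ                    ≡⟨ strip-idem μ ⟨
  strip (strip μ)            ≡⟨ OneVar⇒≃ (strip μ) μ1 ⟩
  strip (sum (strip μ) ∷ []) ≡⟨ cong (λ s → strip (s ∷ [])) (sum-strip μ) ⟩
  strip (sum μ ∷ [])         ∎
  where open ≡-Reasoning

≃-OneVar : ∀ e μ → OneVar e → e ≃ μ → OneVar (strip μ)
≃-OneVar e μ e1 e≃μ = subst OneVar e≃μ (≤-trans (length-strip e) e1)

sum≡⇒≃ : ∀ e μ → OneVar e → OneVar (strip μ) → sum e ≡ sum μ → e ≃ μ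
sum≡⇒≃ e μ e1 μ1 eq =
  trans (OneVar⇒≃ e e1) (trans (cong (λ s → strip (s ∷ [])) eq) (sym (OneVar-strip⇒≃ μ μ1)))

OneVar-addU : ∀ e f → OneVar e → OneVar f → OneVar (addU e f)
OneVar-addU []          f           _        f1       = f1
OneVar-addU (a ∷ [])    []          e1       _        = e1
OneVar-addU (a ∷ [])    (b ∷ [])    _        _        = s≤s z≤n
OneVar-addU (a ∷ [])    (_ ∷ _ ∷ _) _        (s≤s ())
OneVar-addU (_ ∷ _ ∷ _) f           (s≤s ()) _

Univariate : IPoly → Set
Univariate = All (OneVar ∘ proj₂)

coeffI-univariate : ∀ P → Univariate P → ∀ μ → OneVar (strip μ) → coeffI P μ ≡ coeffU (collapse P) (sum μ)
coeffI-univariate []            []           μ μ1 = refl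
coeffI-univariate ((c , e) ∷ P) (e1 ∷ P-uni) μ μ1 with e ≃? μ
... | yes e≃μ = trans (cong₂ _+_ (sym (coeffU-monoU-≃ c e μ e≃μ)) (coeffI-univariate P P-uni μ μ1))
                      (sym (coeffU-collapse-∷ c e P (sum μ)))
... | no  e≄μ = trans (cong₂ _+_ (sym (coeffU-monoU-≢ c (e≄μ ∘ sum≡⇒≃ e μ e1 μ1)))
                                 (coeffI-univariate P P-uni μ μ1))
                      (sym (coeffU-collapse-∷ c e P (sum μ)))

coeffI-univariate-¬OneVar : ∀ P → Univariate P → ∀ μ → ¬ OneVar (strip μ) → coeffI P μ ≡ 0
coeffI-univariate-¬OneVar []            []           μ ¬μ1 = refl
coeffI-univariate-¬OneVar ((c , e) ∷ P) (e1 ∷ P-uni) μ ¬μ1 with e ≃? μ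
... | yes e≃μ = contradiction (≃-OneVar e μ e1 e≃μ) ¬μ1
... | no  _   = coeffI-univariate-¬OneVar P P-uni μ ¬μ1

collapse-injective : ∀ P Q → Univariate P → Univariate Q → collapse P ≈U collapse Q → P ≈I Q
collapse-injective P Q P-uni Q-uni P≈Q μ with length (strip μ) ≤? 1
... | yes μ1 = trans (coeffI-univariate P P-uni μ μ1)
                     (trans (P≈Q (sum μ)) (sym (coeffI-univariate Q Q-uni μ μ1)))
... | no ¬μ1 = trans (coeffI-univariate-¬OneVar P P-uni μ ¬μ1)
                     (sym (coeffI-univariate-¬OneVar Q Q-uni μ ¬μ1))

Univariate-mulI-term : ∀ c e q → OneVar e → Univariate q → Univariate (mulI ((c , e) ∷ []) q)
Univariate-mulI-term c e []            e1 []           = []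
Univariate-mulI-term c e ((d , f) ∷ q) e1 (f1 ∷ q-uni) =
  OneVar-addU e f e1 f1 ∷ Univariate-mulI-term c e q e1 q-uni

Univariate-mulI : ∀ p q → Univariate p → Univariate q → Univariate (mulI p q)
Univariate-mulI []            q []           q-uni = []
Univariate-mulI ((c , e) ∷ p) q (e1 ∷ p-uni) q-uni = subst Univariate (sym (mulI-∷ (c , e) p q))
  (AllP.++⁺ (Univariate-mulI-term c e q e1 q-uni) (Univariate-mulI p q p-uni q-uni))

embedFrom : ℕ → UPoly → IPoly
embedFrom i []      = []
embedFrom i (a ∷ p) = (a , i ∷ []) ∷ embedFrom (suc i) p

embed : UPoly → IPoly
embed = embedFrom 0

Univariate-embedFrom : ∀ i p → Univariate (embedFrom i p)
Univariate-embedFrom i []      = []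
Univariate-embedFrom i (a ∷ p) = s≤s z≤n ∷ Univariate-embedFrom (suc i) p

shiftU : ℕ → UPoly → UPoly
shiftU zero    p = p
shiftU (suc i) p = 0 ∷ shiftU i p

shiftU-[] : ∀ i → shiftU i [] ≈U []
shiftU-[] zero    k       = refl
shiftU-[] (suc i) zero    = refl
shiftU-[] (suc i) (suc k) = shiftU-[] i k

shiftU-∷ : ∀ i a p → shiftU i (a ∷ p) ≈U addU (monoU a i) (shiftU (suc i) p)
shiftU-∷ zero    a p zero    = sym (+-identityʳ a)
shiftU-∷ zero    a p (suc k) = refl
shiftU-∷ (suc i) a p zero    = refl
shiftU-∷ (suc i) a p (suc k) = shiftU-∷ i a p k

collapse-embedFrom : ∀ i p → collapse (embedFrom i p) ≈U shiftU i p
collapse-embedFrom i []      k = sym (shiftU-[] i k)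
collapse-embedFrom i (a ∷ p) k = begin
  coeffU (collapse ((a , i ∷ []) ∷ embedFrom (suc i) p)) k   ≡⟨ coeffU-collapse-∷ a (i ∷ []) (embedFrom (suc i) p) k ⟩
  coeffU (monoU a (i + 0)) k + coeffU (collapse (embedFrom (suc i) p)) k
                                ≡⟨ cong₂ _+_ (cong (λ j → coeffU (monoU a j) k) (+-identityʳ i))
                                             (collapse-embedFrom (suc i) p k) ⟩
  coeffU (monoU a i) k + coeffU (shiftU (suc i) p) k         ≡⟨ coeffU-addU (monoU a i) (shiftU (suc i) p) k ⟨
  coeffU (addU (monoU a i) (shiftU (suc i) p)) k             ≡⟨ shiftU-∷ i a p k ⟨
  coeffU (shiftU i (a ∷ p)) k                                ∎
  where open ≡-Reasoning

collapse-embed : ∀ p → collapse (embed p) ≈U p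
collapse-embed = collapse-embedFrom 0

Univariate-embed : ∀ p → Univariate (embed p)
Univariate-embed = Univariate-embedFrom 0

coeffI-embed : ∀ p μ → OneVar (strip μ) → coeffI (embed p) μ ≡ coeffU p (sum μ)
coeffI-embed p μ μ1 = trans (coeffI-univariate (embed p) (Univariate-embed p) μ μ1) (collapse-embed p (sum μ))

embed-In : ∀ p → InT p → InP∞ (embed p)
embed-In p (p₀≡0 , k , pₖ≢0) =
  trans (coeffI-embed p [] z≤n) p₀≡0 ,
  k ∷ [] , λ eq → pₖ≢0 (trans (cong (coeffU p) (sym (+-identityʳ k)))
                              (trans (sym (coeffI-embed p (k ∷ []) (length-strip (k ∷ [])))) eq))

embed-cong : ∀ p q → p ≈U q → embed p ≈I embed q
embed-cong p q p≈q = collapse-injective (embed p) (embed q) (Univariate-embed p) (Univariate-embed q)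
  (λ k → trans (collapse-embed p k) (trans (p≈q k) (sym (collapse-embed q k))))

-- Univariate is carried along so that collapse-injective applies to the evaluated pattern.
embed-simulation : Simulation algP∞ algT
embed-simulation = record
  { _∼_    = λ x y → Univariate x × collapse x ≈U y
  ; 0∼0    = [] , λ k → refl
  ; 1∼1    = z≤n ∷ [] , λ k → refl
  ; ⊕-pres = λ {x} {y} {x′} {y′} (x-uni , x≈) (x′-uni , x′≈) →
      AllP.++⁺ x-uni x′-uni ,
      λ k → trans (collapse-++ x x′ k) (addU-cong {collapse x} {y} {collapse x′} {y′} x≈ x′≈ k)
  ; ⊗-pres = λ {x} {y} {x′} {y′} (x-uni , x≈) (x′-uni , x′≈) →
      Univariate-mulI x x′ x-uni x′-uni ,
      λ k → trans (collapse-mulI x x′ k) (mulU-cong {collapse x} {y} {collapse x′} {y′} x≈ x′≈ k)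
  }

embed-Morphism : Morphism domT domP∞
embed-Morphism = record
  { fun       = embed
  ; fun-In    = λ {p} → embed-In p
  ; fun-cong  = λ {p} {q} → embed-cong p q
  ; fun-evalM = λ F a →
      let (Fa-uni , Fa≈) = evalM-sim-map embed-simulation embed (λ p → Univariate-embed p , collapse-embed p) F a
          Fa = evalM algT F a
      in collapse-injective _ (embed Fa) Fa-uni (Univariate-embed Fa)
           (λ k → trans (Fa≈ k) (sym (collapse-embed Fa k)))
  }

addPRF : PRF 2
addPRF = cR (cP fzero) (cC cS (cP (fsuc fzero) ∷ []))

addPRF-correct : ∀ a b → ⟦ addPRF ⟧ (a ∷ b ∷ []) ≡ a + b
addPRF-correct zero    b = refl
addPRF-correct (suc a) b = cong suc (addPRF-correct a b)

mulPRF : PRF 2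
mulPRF = cR cZ (cC addPRF (cP (fsuc (fsuc fzero)) ∷ cP (fsuc fzero) ∷ []))

mulPRF-correct : ∀ a b → ⟦ mulPRF ⟧ (a ∷ b ∷ []) ≡ a * b
mulPRF-correct zero    b = refl
mulPRF-correct (suc a) b = trans (addPRF-correct b _) (cong (b +_) (mulPRF-correct a b))

PrimRec-suc : ∀ {f} → PrimRec f → PrimRec (suc ∘ f)
PrimRec-suc (cf , cf≗f) = cC cS (cf ∷ []) , cong suc ∘ cf≗f

PrimRec-* : ∀ {f g} → PrimRec f → PrimRec g → PrimRec (λ n → f n * g n)
PrimRec-* (cf , cf≗f) (cg , cg≗g) = cC mulPRF (cf ∷ cg ∷ []) , λ n →
  trans (mulPRF-correct (⟦ cf ⟧ (n ∷ [])) (⟦ cg ⟧ (n ∷ []))) (cong₂ _*_ (cf≗f n) (cg≗g n))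

sum≤length*max : ∀ p d c → (∀ k → d ≤ k → coeffU p k ≡ 0) → (∀ k → coeffU p k ≤ c) → sum p ≤ d * c
sum≤length*max []      d       c _     _   = z≤n
sum≤length*max (a ∷ p) zero    c deg≤ coef≤ =
  +-mono-≤ (≤-reflexive (deg≤ 0 z≤n)) (sum≤length*max p zero c (λ k _ → deg≤ (suc k) z≤n) (coef≤ ∘ suc))
sum≤length*max (a ∷ p) (suc d) c deg≤ coef≤ =
  +-mono-≤ (coef≤ 0) (sum≤length*max p d c (λ k d≤k → deg≤ (suc k) (s≤s d≤k)) (coef≤ ∘ suc))

sum≤size² : ∀ p c → SizeT≤ p c → sum p ≤ suc c * suc c
sum≤size² p c size≤ =
  ≤-trans (sum≤length*max p (suc c) c (proj₁ ∘ size≤) (proj₂ ∘ size≤)) (*-monoʳ-≤ (suc c) (n≤1+n c))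

module _ {M n : ℕ} (χ : ColoringUpTo M (suc n)) where

  extend : Coloring domℕ (suc n)
  extend = colour , λ { x .x _ _ refl → cong (colour x) (≤-irrelevant _ _) }
    where
      colour : (x : ℕ) → 1 ≤ x → Fin (suc n)
      colour x 1≤x with x ≤? M
      ... | yes x≤M = χ x 1≤x x≤M
      ... | no  _   = fzero

  extend-agrees : ∀ x (1≤x : 1 ≤ x) (x≤M : x ≤ M) → proj₁ extend x 1≤x ≡ χ x 1≤x x≤M
  extend-agrees x 1≤x x≤M with x ≤? M
  ... | yes x≤M′ = cong (χ x 1≤x) (≤-irrelevant x≤M′ x≤M)
  ... | no  x≰M  = contradiction x≤M x≰M

PRT-bounded⇒PRℕ-bounded : ∀ {m r} (F : Vec (MPoly m) r) → PRT-bounded F → PRℕ-bounded F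
PRT-bounded⇒PRℕ-bounded F (N , N-primrec , prT) =
  bound , PrimRec-* (PrimRec-suc N-primrec) (PrimRec-suc N-primrec) , λ where
    zero    χ → case χ 1 (s≤s z≤n) (s≤s z≤n) of λ ()
    (suc n) χ →
      let (a , c , instance-T , size≤) = prT (suc n) (pullback sum-Morphism (extend χ))
          (a∈ℕ , Fa∈ℕ) = push-MonoInstance sum-Morphism In-closed-ℕ F (extend χ) instance-T
      in Vec.map sum a , c , a∈ℕ , λ j →
           let (Fja∈ℕ , colour) = Fa∈ℕ j
               Fja≤bound = subst (_≤ bound (suc n)) (sym (fun-evalM (lookup F j) a))
                                 (sum≤size² (evalM algT (lookup F j) a) (N (suc n)) (size≤ j))
           in Fja∈ℕ , Fja≤bound , trans (sym (extend-agrees χ _ Fja∈ℕ Fja≤bound)) colour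
  where
    open Morphism sum-Morphism using (fun-evalM)
    bound : ℕ → ℕ
    bound n = suc (N n) * suc (N n)

mainTheorem4 : ∀ {m r} (F : Vec (MPoly m) r) → (∀ (j : Fin r) → Good (lookup F j)) →
    (PartitionRegular domP∞ F ⇔ PartitionRegular domT F)
    × (PartitionRegular domT F → PartitionRegular domℕ F)
    × (PRT-bounded F → PRℕ-bounded F)
mainTheorem4 F _ =
  mk⇔ (PartitionRegular-transfer collapse-Morphism In-closed-T F)
      (PartitionRegular-transfer embed-Morphism In-closed-P∞ F) ,
  PartitionRegular-transfer sum-Morphism In-closed-ℕ F ,
  PRT-bounded⇒PRℕ-bounded F
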